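{- Let $\mathcal{P}=\mathrm{grp}\langle X,\ \omega:R\to F(X)\rangle$ be a group presentation of a group $G$, with quotient morphism $\phi:F(X)\to G$, and suppose $\mathcal{P}$ has a complete logged rewrite system $\mathcal{L}(\mathcal{P})$. Let $\sigma:G\to F(X)$ be the section of $\phi$ sending each $g\in G$ to (the free group element represented by) the unique $\mathcal{R}_{\mathcal{L}}$-irreducible word in $\bar X^*$ representing $g$. Then the logged information of $\mathcal{L}(\mathcal{P})$ determines a groupoid morphism $k_1:F(\widetilde X)\to C(R)$, namely: for each edge $[g,x]$ of the Cayley graph, $k_1[g,x]$ is an element of $C(R)$ of the form $[L(w)]$, where $w=\mu_X\big((\sigma g)\,x\,(\sigma(g(\phi x)))^{ -1}\big)$ and $L(w)$ is a log Y-sequence of a logged reduction of $w$ with respect to $\mathcal{L}(\mathcal{P})$ (taken to be $[\lambda_{\bar Y}]$ whenever possible), extended to paths multiplicatively; it satisfies $\delta_2 k_1[g,x]=(\sigma g)\,x\,(\sigma(g(\phi x)))^{ -1}$ for all $g\in G$, $x\in X$. For this $k_1$, the elements $$\iota_{[g,\rho]}=(\rho^-)^{(\sigma g)^{ -1}}\,\big(k_1[g,\omega\rho]\big)\in C(R),\qquad g\in G,\ \rho\in R,$$ form a complete set of generators for $\Pi_2(\mathcal{P})=\ker\delta_2$ as a $\mathbb{Z}G$-module.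
   Context: Notation. For a set $A$, $F(A)$ is the free group and $A^*$ the free monoid on $A$, with empty word $\lambda_A$. Put $\bar A=\{a^+:a\in A\}\sqcup\{a^-:a\in A\}$, with $(a^+)^-=a^-$, $(a^-)^-=a^+$, extended to words by $w^-$ = formal inverse. $\mu_A:F(A)\to\bar A^*/\{a^+a^-=\lambda=a^-a^+\}$ is the isomorphism $a\mapsto a^+$, $a^{ -1}\mapsto a^-$; words in $\bar X^*$ and elements of $F(X)$ are identified via $\mu_X$ where convenient. A presentation $\mathcal{P}=\mathrm{grp}\langle X,\omega:R\to F(X)\rangle$ has generators $X$, relator labels $R$, and $\omega$ giving each relator as a word; $G=F(X)/N$ where $N$ is the normal closure of $\omega(R)$, $\phi:F(X)\to G$ the quotient. Let $\bar\omega\rho=\mu_X(\omega\rho)$. Crossed module of consequences. Let $Y=R\times F(X)$; elements of $\bar Y$ are written $(\rho^\epsilon)^u$ ($\rho\in R$, $u\in F(X)$, $\epsilon\in\{+,-\}$), and elements of $\bar Y^*$ are Y-sequences. $F(X)$ acts by $((\rho^\epsilon)^u)^v=(\rho^\epsilon)^{uv}$, extended to $\bar Y^*$ termwise. $\delta:\bar Y^*\to F(X)$ is the monoid morphism with $\delta((\rho^+)^u)=u^{ -1}(\omega\rho)u$, $\delta((\rho^-)^u)=u^{ -1}(\omega\rho)^{ -1}u$. The Peiffer congruence $=_P$ on $\bar Y^*$ is generated by $(y^-zy^+,\ z^{\delta y})$ and $(y^+y^-,\lambda_{\bar Y})$ for $y,z\in\bar Y$. $C(R)=\bar Y^*/{=_P}$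 (a group, the free crossed $F(X)$-module on $\omega$), with $[c]^u=[c^u]$ and $\delta_2[c]=\delta c$. $\Pi_2(\mathcal{P})=\ker\delta_2$, the module of identities among relations, a $\mathbb{Z}G$-module. Logged rewrite systems. A logged rewrite system for $\mathcal{P}$ is a finite set of triples $(l_i,c_i,r_i)$ with $l_i,r_i\in\bar X^*$, $c_i\in\bar Y^*$, such that $\mathcal{R}_{\mathcal L}=\{(l_i,r_i)\}$ is a string rewriting system for $G$ on $\bar X$ (i.e. $\bar X^*$ modulo the congruence generated by $\mathcal{R}_{\mathcal L}$ is isomorphic to $G$ via the natural map) and $l_i=\mu_X(\delta c_i)\,r_i$. It is complete if $\mathcal{R}_{\mathcal L}$ is a complete (Noetherian and confluent) rewriting system. A logged reduction of $w\in\bar X^*$: start with $z_0=w$, $L_0=\lambda_{\bar Y}$; while $z_i=ulv$ for some rule $(l,c,r)$ and $u,v\in\bar X^*$, set $z_{i+1}=urv$ and $L_{i+1}=L_i\,c^{u^{ -1}}$; on termination output the irreducible word $I(w)$ and log $L(w)$, so that $w=\delta(L(w))\,I(w)$. Cayley graph and groupoid. $\widetilde X$ is the Cayley graph of $\mathcal{P}$: vertices are the elements of $G$, edges $[g,x]:g\to g(\phi x)$ for $g\in G$, $x\in X$. $F(\widetilde X)$ is the free groupoid on $\widetilde X$, whose paths are written $[g,u]:g\to g(\phi u)$ for $u\in F(X)$ (the path from $g$ following the letters of $u$, traversing edges backwards for inverse letters). $C(R)$ is regarded as a one-object groupoid, and $k_1[g,\omega\rho]$ is the image of the closed path $[g,\omega\rho]$.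 -}

module Defs where

open import Data.List using (List; []; _∷_; _++_; map; reverse; concatMap)
open import Data.List.Membership.Propositional using (_∈_)
open import Data.Product using (Σ; ∃; _×_; _,_)
open import Relation.Binary.PropositionalEquality using (_≡_)
open import Relation.Binary.Construct.Closure.ReflexiveTransitive using (Star)
open import Relation.Binary.Construct.Closure.Equivalence using (EqClosure)
open import Relation.Nullary using (¬_)
open import Induction.WellFounded using (WellFounded)
open import Function.Bundles using (_⇔_)

data Sgn : Set where
  pos neg : Sgn

flipS : Sgn → Sgn
flipS pos = neg
flipS neg = pos

Lit : Set → Set
Lit X = Sgn × X

Word : Set → Set
Word X = List (Lit X)

invLit : ∀ {X : Set} → Lit X → Lit X
invLit (s , a) = (flipS s , a)

invW : ∀ {X : Set} → Word X → Word X
invW w = reverse (map invLit w)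

-- free equivalence: the congruence on X̄* generated by a⁺a⁻ = λ = a⁻a⁺.
-- Two words are ≈F iff they represent the same element of F(X) (via μ_X).
data _≈F_ {X : Set} : Word X → Word X → Set where
  cancel : ∀ u v a → (u ++ a ∷ invLit a ∷ v) ≈F (u ++ v)
  reflF  : ∀ {w} → w ≈F w
  symF   : ∀ {w w'} → w ≈F w' → w' ≈F w
  transF : ∀ {w w' w''} → w ≈F w' → w' ≈F w'' → w ≈F w''

module Pres (X R : Set) (ω : R → Word X) where

  -- the congruence on X̄* whose quotient is G = F(X)/N
  data _~N_ : Word X → Word X → Set where
    freeN  : ∀ {w w'} → w ≈F w' → w ~N w'
    relN   : ∀ u v ρ → (u ++ ω ρ ++ v) ~N (u ++ v)
    symN   : ∀ {w w'} → w ~N w' → w' ~N w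
    transN : ∀ {w w' w''} → w ~N w' → w' ~N w'' → w ~N w''

  -- elements of Ȳ, Y = R × F(X): (ρ^ε)^u is (ρ , ε , u), u a word representing u ∈ F(X)
  Ysym : Set
  Ysym = R × Sgn × Word X

  Yseq : Set
  Yseq = List Ysym

  actY : Ysym → Word X → Ysym
  actY (ρ , ε , u) v = (ρ , ε , u ++ v)

  act : Yseq → Word X → Yseq
  act c v = map (λ y → actY y v) c

  invY : Ysym → Ysym
  invY (ρ , ε , u) = (ρ , flipS ε , u)

  invYs : Yseq → Yseq
  invYs c = reverse (map invY c)

  relWord : R → Sgn → Word X
  relWord ρ pos = ω ρ
  relWord ρ neg = invW (ω ρ)

  δY : Ysym → Word X
  δY (ρ , ε , u) = invW u ++ relWord ρ ε ++ u

  δ : Yseq → Word X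
  δ c = concatMap δY c

  -- Peiffer congruence =_P on Ȳ* (also identifying (ρ^ε)^u, (ρ^ε)^{u'} when u = u' in F(X));
  -- C(R) = Ȳ* / ≈P
  data _≈P_ : Yseq → Yseq → Set where
    peiffer : ∀ y z → (invY y ∷ z ∷ y ∷ []) ≈P (actY z (δY y) ∷ [])
    cancelP : ∀ y → (y ∷ invY y ∷ []) ≈P []
    freeY   : ∀ ρ ε {u u'} → u ≈F u' → ((ρ , ε , u) ∷ []) ≈P ((ρ , ε , u') ∷ [])
    ctxP    : ∀ a b {s t} → s ≈P t → (a ++ s ++ b) ≈P (a ++ t ++ b)
    reflP   : ∀ {c} → c ≈P c
    symP    : ∀ {c c'} → c ≈P c' → c' ≈P c
    transP  : ∀ {c c' c''} → c ≈P c' → c' ≈P c'' → c ≈P c''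

  InPi2 : Yseq → Set
  InPi2 c = δ c ≈F []

  signedYs : Yseq → Sgn → Yseq
  signedYs c pos = c
  signedYs c neg = invYs c

  -- c lies in the ZG-submodule of Π₂ generated by the family ι : I → C(R):
  -- since Π₂ is central in C(R) and the G-action is induced by the F(X)-action,
  -- this is the subgroup generated by all ι i ^ u (u ∈ F(X)).
  GeneratedBy : {I : Set} → (I → Yseq) → Yseq → Set
  GeneratedBy {I} ι c =
    Σ (List (I × Word X × Sgn)) λ gs →
      c ≈P concatMap (λ { (i , u , s) → act (signedYs (ι i) s) u }) gs

  Rule : Set
  Rule = Word X × Yseq × Word X

  module Logged (𝓛 : List Rule) where

    lhs rhs : Rule → Word X
    lhs (l , _ , _) = l
    rhs (_ , _ , r) = r

    Step : Word X → Word X → Set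
    Step w w' = Σ Rule λ t → t ∈ 𝓛 × Σ (Word X) λ u → Σ (Word X) λ v →
                  (w ≡ u ++ lhs t ++ v) × (w' ≡ u ++ rhs t ++ v)

    Irreducible : Word X → Set
    Irreducible w = ∀ w' → ¬ Step w w'

    _↔*_ : Word X → Word X → Set
    _↔*_ = EqClosure Step

    IsLoggedRewriteSystem : Set
    IsLoggedRewriteSystem =
      (∀ w w' → (w ↔* w') ⇔ (w ~N w')) ×
      (∀ l c r → (l , c , r) ∈ 𝓛 → l ≈F (δ c ++ r))

    Noetherian : Set
    Noetherian = WellFounded (λ w' w → Step w w')

    Confluent : Set
    Confluent = ∀ a b c → Star Step a b → Star Step a c →
                  Σ (Word X) λ d → Star Step b d × Star Step c d

    IsCompleteLoggedRewriteSystem : Set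
    IsCompleteLoggedRewriteSystem = IsLoggedRewriteSystem × Noetherian × Confluent

    data Reduces : Word X → Yseq → Word X → Yseq → Set where
      done : ∀ {z L} → Irreducible z → Reduces z L z L
      step : ∀ {l c r u v L z' L'} → (l , c , r) ∈ 𝓛 →
             Reduces (u ++ r ++ v) (L ++ act c (invW u)) z' L' →
             Reduces (u ++ l ++ v) L z' L'

    IsLogOf : Word X → Yseq → Set
    IsLogOf w L = Σ (Word X) λ z → Reduces w [] z L

    IsNormalForm : (Word X → Word X) → Set
    IsNormalForm nf = ∀ w → Irreducible (nf w) × (nf w ~N w)

    module WithNF (nf : Word X → Word X) where

      -- vertices of the Cayley graph are represented by irreducible words g (σ g = g);
      -- the vertex g·(φ a) for a letter a
      move : Word X → Lit X → Word X
      move g a = nf (g ++ a ∷ [])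

      edgeWord : Word X → X → Word X
      edgeWord g x = g ++ (pos , x) ∷ [] ++ invW (move g (pos , x))

      IsK1Choice : (Word X → X → Yseq) → Set
      IsK1Choice kk = ∀ g → Irreducible g → ∀ x →
        ((edgeWord g x ≈F []) → kk g x ≡ []) ×
        (¬ (edgeWord g x ≈F []) → IsLogOf (edgeWord g x) (kk g x))

      k1Path : (Word X → X → Yseq) → Word X → Word X → Yseq
      k1Path kk g [] = []
      k1Path kk g ((pos , x) ∷ w) = kk g x ++ k1Path kk (move g (pos , x)) w
      k1Path kk g ((neg , x) ∷ w) =
        invYs (kk (move g (neg , x)) x) ++ k1Path kk (move g (neg , x)) w

      iota : (Word X → X → Yseq) → (Σ (Word X) Irreducible × R) → Yseq
      iota kk ((g , _) , ρ) = (ρ , neg , invW g) ∷ k1Path kk g (ω ρ)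

{-# OPTIONS --safe #-}
-- A logged reduction of the edge word (σ g) x (σ (g x))⁻¹ to the empty word records
-- δ (kk g x) = (σ g) x (σ (g x))⁻¹, so the extension k₁[g, w] of kk along Cayley-graph paths
-- respects free equivalence and has boundary (σ g) w (σ (g w))⁻¹; in particular each ι lies in Π₂.
-- For a generator y = (ρ^ε)^u of C(R) and h = σ(u⁻¹), k₁[1, δ y] is the conjugate of
-- k₁[h, ρ^ε] = (ρ^ε)^(h⁻¹) ι_[h,ρ]^ε by k₁[1, u⁻¹], whose boundary is h u, so
-- y = k₁[1, δ y] · (ι_[h,ρ]^(-ε))^(h u). Since Π₂ is central in C(R), induction on c gives
-- c = k₁[1, δ c] · a with a in the submodule generated by the ι's, and k₁[1, δ c] = 1 when c ∈ Π₂.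
module Submission where

open import Defs
open import Data.List using (List; []; _∷_; _++_; _∷ʳ_; map; reverse; foldl; length; initLast; _∷ʳ′_)
open import Data.List.Membership.Propositional using (_∈_)
open import Data.List.Properties
  using (++-assoc; ++-identityʳ; ++-conicalˡ; ++-conicalʳ; ++-monoid; ∷-injective; ∷ʳ-injective;
         map-++; map-∘; map-cong; map-id; reverse-++; reverse-map; reverse-involutive; concatMap-++; length-++)
open import Data.Nat using (_<_; _+_; s≤s)
open import Data.Nat.Properties using (<-trans; +-monoʳ-<; n≤1+n; module ≤-Reasoning)
open import Data.Nat.Induction using (<-wellFounded)
open import Data.Empty using (⊥)
open import Data.Product using (Σ; ∃; _×_; _,_; proj₁; proj₂)
open import Data.Sum using (_⊎_; inj₁; inj₂)
open import Function using (_∘_; id)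
open import Function.Bundles using (Equivalence; _⇔_; mk⇔)
open import Induction.WellFounded using (Acc; acc; module Subrelation)
open import Relation.Binary.Bundles using (Setoid)
open import Relation.Binary.Construct.Closure.Equivalence using (EqClosure; symmetric)
open import Relation.Binary.Construct.Closure.ReflexiveTransitive using (Star; ε; _◅_; _◅◅_; gmap)
open import Relation.Binary.Construct.Closure.Symmetric using (fwd)
open import Relation.Binary.Construct.Closure.Transitive using (Plus; [_]; _∼⁺⟨_⟩_)
import Relation.Binary.Construct.On as On
open import Relation.Binary.PropositionalEquality
import Relation.Binary.Reasoning.Setoid as SetoidReasoning
open import Relation.Binary.Rewriting using (WeaklyConfluent; sn&wcr⇒cr; conf⇒unf; conf⇒nf)
  renaming (IsNormalForm to IsNormal; Confluent to IsConfluent)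
open import Relation.Nullary using (¬_)
open import Tactic.MonoidSolver using (solve)

module _ {A : Set} (f : A → A) where

  reverse-map-++ : ∀ xs ys → reverse (map f (xs ++ ys)) ≡ reverse (map f ys) ++ reverse (map f xs)
  reverse-map-++ xs ys = trans (cong reverse (map-++ f xs ys)) (reverse-++ (map f xs) (map f ys))

  reverse-map-involutive : (∀ a → f (f a) ≡ a) → ∀ xs → reverse (map f (reverse (map f xs))) ≡ xs
  reverse-map-involutive f-involutive xs = begin
    reverse (map f (reverse (map f xs))) ≡⟨ cong reverse (reverse-map f (map f xs)) ⟩
    reverse (reverse (map f (map f xs))) ≡⟨ reverse-involutive (map f (map f xs)) ⟩
    map f (map f xs)                     ≡⟨ map-∘ xs ⟨
    map (f ∘ f) xs                       ≡⟨ map-cong f-involutive xs ⟩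
    map id xs                            ≡⟨ map-id xs ⟩
    xs                                   ∎
    where open ≡-Reasoning

≈F-setoid : Set → Setoid _ _
≈F-setoid X = record
  { Carrier = Word X ; _≈_ = _≈F_
  ; isEquivalence = record { refl = reflF ; sym = symF ; trans = transF } }

module ≈F-Reasoning {X : Set} = SetoidReasoning (≈F-setoid X)

flipS-involutive : ∀ s → flipS (flipS s) ≡ s
flipS-involutive pos = refl
flipS-involutive neg = refl

module _ {X : Set} where

  invLit-involutive : (a : Lit X) → invLit (invLit a) ≡ a
  invLit-involutive (s , x) = cong (_, x) (flipS-involutive s)

  invW-++ : (u v : Word X) → invW (u ++ v) ≡ invW v ++ invW u
  invW-++ = reverse-map-++ invLit

  invW-involutive : (w : Word X) → invW (invW w) ≡ w
  invW-involutive = reverse-map-involutive invLit invLit-involutive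

  ≡⇒≈F : {w w' : Word X} → w ≡ w' → w ≈F w'
  ≡⇒≈F refl = reflF

  ≈F-congˡ : ∀ (p : Word X) {w w'} → w ≈F w' → (p ++ w) ≈F (p ++ w')
  ≈F-congˡ p (cancel u v a) =
    transF (≡⇒≈F (sym (++-assoc p u _))) (transF (cancel (p ++ u) v a) (≡⇒≈F (++-assoc p u v)))
  ≈F-congˡ p reflF          = reflF
  ≈F-congˡ p (symF e)       = symF (≈F-congˡ p e)
  ≈F-congˡ p (transF e e')  = transF (≈F-congˡ p e) (≈F-congˡ p e')

  ≈F-congʳ : ∀ (q : Word X) {w w'} → w ≈F w' → (w ++ q) ≈F (w' ++ q)
  ≈F-congʳ q (cancel u v a) =
    transF (≡⇒≈F (++-assoc u _ q)) (transF (cancel u (v ++ q) a) (≡⇒≈F (sym (++-assoc u v q))))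
  ≈F-congʳ q reflF          = reflF
  ≈F-congʳ q (symF e)       = symF (≈F-congʳ q e)
  ≈F-congʳ q (transF e e')  = transF (≈F-congʳ q e) (≈F-congʳ q e')

  ≈F-cong : {a a' b b' : Word X} → a ≈F a' → b ≈F b' → (a ++ b) ≈F (a' ++ b')
  ≈F-cong {a' = a'} {b = b} e e' = transF (≈F-congʳ b e) (≈F-congˡ a' e')

  ≈F-delete : ∀ (p q : Word X) {w} → w ≈F [] → (p ++ w ++ q) ≈F (p ++ q)
  ≈F-delete p q e = ≈F-congˡ p (≈F-congʳ q e)

  invW-inverseʳ : (w : Word X) → (w ++ invW w) ≈F []
  invW-inverseʳ []      = reflF
  invW-inverseʳ (a ∷ w) =
    transF (≡⇒≈F (cong (a ∷_) reassoc))
           (transF (≈F-delete (a ∷ []) (invLit a ∷ []) (invW-inverseʳ w)) (cancel [] [] a))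
    where
    reassoc : w ++ invW (a ∷ w) ≡ (w ++ invW w) ++ invLit a ∷ []
    reassoc = trans (cong (w ++_) (invW-++ (a ∷ []) w)) (sym (++-assoc w (invW w) _))

  invW-inverseˡ : (w : Word X) → (invW w ++ w) ≈F []
  invW-inverseˡ w = transF (≡⇒≈F (cong (invW w ++_) (sym (invW-involutive w)))) (invW-inverseʳ (invW w))

  invW-cong : {w w' : Word X} → w ≈F w' → invW w ≈F invW w'
  invW-cong (cancel u v a) = begin
    invW (u ++ a ∷ invLit a ∷ v)                       ≡⟨ invW-++ u (a ∷ invLit a ∷ v) ⟩
    invW (a ∷ invLit a ∷ v) ++ invW u                  ≡⟨ cong (_++ invW u) (invW-++ (a ∷ invLit a ∷ []) v) ⟩
    (invW v ++ invLit (invLit a) ∷ invLit a ∷ []) ++ invW u ≡⟨ ++-assoc (invW v) _ (invW u) ⟩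
    invW v ++ invLit (invLit a) ∷ invLit a ∷ invW u
      ≡⟨ cong (λ b → invW v ++ b ∷ invLit a ∷ invW u) (invLit-involutive a) ⟩
    invW v ++ a ∷ invLit a ∷ invW u                    ≈⟨ cancel (invW v) (invW u) a ⟩
    invW v ++ invW u                                   ≡⟨ invW-++ u v ⟨
    invW (u ++ v)                                      ∎
    where open ≈F-Reasoning
  invW-cong reflF          = reflF
  invW-cong (symF e)       = symF (invW-cong e)
  invW-cong (transF e e')  = transF (invW-cong e) (invW-cong e')

  invW-∷-invW : ∀ (u : Word X) a v → invW (u ++ a ∷ invW v) ≡ v ++ invLit a ∷ invW u
  invW-∷-invW u a v = begin
    invW (u ++ a ∷ invW v)               ≡⟨ invW-++ u (a ∷ invW v) ⟩
    invW (a ∷ invW v) ++ invW u          ≡⟨ cong (_++ invW u) (invW-++ (a ∷ []) (invW v)) ⟩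
    (invW (invW v) ++ invLit a ∷ []) ++ invW u ≡⟨ cong (λ v′ → (v′ ++ invLit a ∷ []) ++ invW u) (invW-involutive v) ⟩
    (v ++ invLit a ∷ []) ++ invW u       ≡⟨ ++-assoc v _ (invW u) ⟩
    v ++ invLit a ∷ invW u               ∎
    where open ≡-Reasoning

  ≈F⇒++-invW≈F[] : {u v : Word X} → u ≈F v → (u ++ invW v) ≈F []
  ≈F⇒++-invW≈F[] {v = v} u≈v = transF (≈F-congʳ (invW v) u≈v) (invW-inverseʳ v)

  ++-invW≈F[]⇒≈F : {u v : Word X} → (u ++ invW v) ≈F [] → u ≈F v
  ++-invW≈F[]⇒≈F {u} {v} e = begin
    u                       ≡⟨ ++-identityʳ u ⟨
    u ++ []                 ≈⟨ ≈F-congˡ u (invW-inverseˡ v) ⟨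
    u ++ invW v ++ v        ≡⟨ ++-assoc u (invW v) v ⟨
    (u ++ invW v) ++ v      ≈⟨ ≈F-congʳ v e ⟩
    v                       ∎
    where open ≈F-Reasoning

  ∷ʳ-invLit-cancel : ∀ (g : Word X) a → ((g ∷ʳ a) ∷ʳ invLit a) ≈F g
  ∷ʳ-invLit-cancel g a =
    transF (≡⇒≈F (++-assoc g (a ∷ []) (invLit a ∷ []))) (transF (cancel g [] a) (≡⇒≈F (++-identityʳ g)))

module FreeReduction {X : Set} where

  FreeStep : Word X → Word X → Set
  FreeStep w w' = Σ (Word X) λ u → Σ (Word X) λ v → Σ (Lit X) λ a →
    w ≡ u ++ a ∷ invLit a ∷ v × w' ≡ u ++ v

  FreelyReduced : Word X → Set
  FreelyReduced = IsNormal FreeStep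

  private
    Joinable : Word X → Word X → Set
    Joinable b c = ∃ λ d → Star FreeStep b d × Star FreeStep c d

    joinable-refl : ∀ {w} → Joinable w w
    joinable-refl = _ , ε , ε

    joinable-step : ∀ {b c d} → FreeStep b d → FreeStep c d → Joinable b c
    joinable-step s t = _ , s ◅ ε , t ◅ ε

    freeStep-∷ : ∀ c {w w'} → FreeStep w w' → FreeStep (c ∷ w) (c ∷ w')
    freeStep-∷ c (u , v , a , refl , refl) = c ∷ u , v , a , refl , refl

    joinable-∷ : ∀ c {b d} → Joinable b d → Joinable (c ∷ b) (c ∷ d)
    joinable-∷ c (e , p , q) = c ∷ e , gmap (c ∷_) (freeStep-∷ c) p , gmap (c ∷_) (freeStep-∷ c) q

    front-redexes-joinable : ∀ a v₁ u₂ b v₂ → a ∷ invLit a ∷ v₁ ≡ u₂ ++ b ∷ invLit b ∷ v₂ →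
                             Joinable v₁ (u₂ ++ v₂)
    front-redexes-joinable a v₁ [] b v₂ refl = joinable-refl
    front-redexes-joinable a v₁ (c ∷ []) b v₂ refl rewrite invLit-involutive a = joinable-refl
    front-redexes-joinable a v₁ (c ∷ d ∷ u₂) b v₂ refl =
      joinable-step (u₂ , v₂ , b , refl , refl) ([] , u₂ ++ v₂ , a , refl , refl)

    redexes-joinable : ∀ u₁ v₁ a u₂ v₂ b → u₁ ++ a ∷ invLit a ∷ v₁ ≡ u₂ ++ b ∷ invLit b ∷ v₂ →
                       Joinable (u₁ ++ v₁) (u₂ ++ v₂)
    redexes-joinable []       v₁ a u₂       v₂ b eq = front-redexes-joinable a v₁ u₂ b v₂ eq
    redexes-joinable (c ∷ u₁) v₁ a []       v₂ b eq
      with (e , p , q) ← front-redexes-joinable b v₂ (c ∷ u₁) a v₁ (sym eq) = e , q , p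
    redexes-joinable (c ∷ u₁) v₁ a (d ∷ u₂) v₂ b eq
      with refl , eq′ ← ∷-injective eq = joinable-∷ c (redexes-joinable u₁ v₁ a u₂ v₂ b eq′)

  freeStep-weaklyConfluent : WeaklyConfluent FreeStep
  freeStep-weaklyConfluent (u₁ , v₁ , a , refl , refl) (u₂ , v₂ , b , eq , refl) =
    redexes-joinable u₁ v₁ a u₂ v₂ b eq

  freeStep-shortens : ∀ {w w'} → FreeStep w w' → length w' < length w
  freeStep-shortens (u , v , a , refl , refl) = begin-strict
    length (u ++ v)                       ≡⟨ length-++ u ⟩
    length u + length v                   <⟨ +-monoʳ-< (length u) (s≤s (n≤1+n (length v))) ⟩
    length u + length (a ∷ invLit a ∷ v)  ≡⟨ length-++ u ⟨
    length (u ++ a ∷ invLit a ∷ v)        ∎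
    where open ≤-Reasoning

  freeSteps-shorten : ∀ {w w'} → Plus FreeStep w w' → length w' < length w
  freeSteps-shorten [ s ]           = freeStep-shortens s
  freeSteps-shorten (_ ∼⁺⟨ p ⟩ q)   = <-trans (freeSteps-shorten q) (freeSteps-shorten p)

  freeStep-confluent : IsConfluent FreeStep
  freeStep-confluent = sn&wcr⇒cr
    (Subrelation.wellFounded freeSteps-shorten (On.wellFounded length <-wellFounded))
    freeStep-weaklyConfluent

  ≈F⇒freeConvertible : ∀ {w w'} → w ≈F w' → EqClosure FreeStep w w'
  ≈F⇒freeConvertible (cancel u v a) = fwd (u , v , a , refl , refl) ◅ ε
  ≈F⇒freeConvertible reflF          = ε
  ≈F⇒freeConvertible (symF e)       = symmetric FreeStep (≈F⇒freeConvertible e)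
  ≈F⇒freeConvertible (transF e e')  = ≈F⇒freeConvertible e ◅◅ ≈F⇒freeConvertible e'

  freelyReduced-unique : ∀ {w w'} → FreelyReduced w → FreelyReduced w' → w ≈F w' → w ≡ w'
  freelyReduced-unique r r' e = conf⇒unf freeStep-confluent r r' (≈F⇒freeConvertible e)

  freelyReduced-∷ʳ : ∀ {g} a → FreelyReduced g → (∀ g' → g ≢ g' ∷ʳ invLit a) → FreelyReduced (g ∷ʳ a)
  freelyReduced-∷ʳ {g} a g-reduced not-cancelling (_ , u , v , b , eq , _) with initLast v
  ... | [] with g≡ , a≡ ← ∷ʳ-injective g (u ∷ʳ b) (trans eq (sym (++-assoc u (b ∷ []) _))) =
    not-cancelling u (trans g≡ (cong (u ∷ʳ_) (trans (sym (invLit-involutive b)) (cong invLit (sym a≡)))))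
  ... | v' ∷ʳ′ c
    with g≡ , _ ← ∷ʳ-injective g (u ++ b ∷ invLit b ∷ v') (trans eq (sym (++-assoc u _ (c ∷ [])))) =
    g-reduced (_ , u , v' , b , g≡ , refl)

module FreeCrossedModule (X R : Set) (ω : R → Word X) where
  open Pres X R ω

  ≡⇒~N : ∀ {w w'} → w ≡ w' → w ~N w'
  ≡⇒~N refl = freeN reflF

  ~N-congˡ : ∀ p {w w'} → w ~N w' → (p ++ w) ~N (p ++ w')
  ~N-congˡ p (freeN e)      = freeN (≈F-congˡ p e)
  ~N-congˡ p (relN u v ρ)   =
    transN (≡⇒~N (sym (++-assoc p u _))) (transN (relN (p ++ u) v ρ) (≡⇒~N (++-assoc p u v)))
  ~N-congˡ p (symN e)       = symN (~N-congˡ p e)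
  ~N-congˡ p (transN e e')  = transN (~N-congˡ p e) (~N-congˡ p e')

  ~N-congʳ : ∀ q {w w'} → w ~N w' → (w ++ q) ~N (w' ++ q)
  ~N-congʳ q (freeN e)      = freeN (≈F-congʳ q e)
  ~N-congʳ q (relN u v ρ)   =
    transN (≡⇒~N (trans (++-assoc u _ q) (cong (u ++_) (++-assoc (ω ρ) v q))))
           (transN (relN u (v ++ q) ρ) (≡⇒~N (sym (++-assoc u v q))))
  ~N-congʳ q (symN e)       = symN (~N-congʳ q e)
  ~N-congʳ q (transN e e')  = transN (~N-congʳ q e) (~N-congʳ q e')

  ~N-setoid : Setoid _ _
  ~N-setoid = record
    { Carrier = Word X ; _≈_ = _~N_
    ; isEquivalence = record { refl = freeN reflF ; sym = symN ; trans = transN } }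

  module ~N-Reasoning = SetoidReasoning ~N-setoid

  ++-relator~N : ∀ g ρ → (g ++ ω ρ) ~N g
  ++-relator~N g ρ =
    transN (≡⇒~N (cong (g ++_) (sym (++-identityʳ (ω ρ))))) (transN (relN g [] ρ) (≡⇒~N (++-identityʳ g)))

  relWord~N[] : ∀ ρ s → relWord ρ s ~N []
  relWord~N[] ρ pos = ++-relator~N [] ρ
  relWord~N[] ρ neg = transN (symN (++-relator~N (invW (ω ρ)) ρ)) (freeN (invW-inverseˡ (ω ρ)))

  δY~N[] : ∀ y → δY y ~N []
  δY~N[] (ρ , s , u) = transN (~N-congˡ (invW u) (~N-congʳ u (relWord~N[] ρ s))) (freeN (invW-inverseˡ u))

  δ-++ : ∀ a b → δ (a ++ b) ≡ δ a ++ δ b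
  δ-++ = concatMap-++ δY

  δY-actY : ∀ y v → δY (actY y v) ≡ invW v ++ δY y ++ v
  δY-actY (ρ , s , u) v = begin
    invW (u ++ v) ++ relWord ρ s ++ u ++ v          ≡⟨ cong (_++ relWord ρ s ++ u ++ v) (invW-++ u v) ⟩
    (invW v ++ invW u) ++ relWord ρ s ++ u ++ v     ≡⟨ solve (++-monoid (Lit X)) ⟩
    invW v ++ (invW u ++ relWord ρ s ++ u) ++ v     ∎
    where open ≡-Reasoning

  δ-act : ∀ c v → δ (act c v) ≈F (invW v ++ δ c ++ v)
  δ-act []      v = symF (invW-inverseˡ v)
  δ-act (y ∷ c) v = begin
    δY (actY y v) ++ δ (act c v)                     ≈⟨ ≈F-cong (≡⇒≈F (δY-actY y v)) (δ-act c v) ⟩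
    (invW v ++ δY y ++ v) ++ (invW v ++ δ c ++ v)   ≡⟨ solve (++-monoid (Lit X)) ⟩
    (invW v ++ δY y) ++ (v ++ invW v) ++ δ c ++ v   ≈⟨ ≈F-delete (invW v ++ δY y) (δ c ++ v) (invW-inverseʳ v) ⟩
    (invW v ++ δY y) ++ δ c ++ v                    ≡⟨ solve (++-monoid (Lit X)) ⟩
    invW v ++ (δY y ++ δ c) ++ v                    ∎
    where open ≈F-Reasoning

  relWord-flipS : ∀ ρ s → relWord ρ (flipS s) ≡ invW (relWord ρ s)
  relWord-flipS ρ pos = refl
  relWord-flipS ρ neg = sym (invW-involutive (ω ρ))

  δY-invY : ∀ y → δY (invY y) ≡ invW (δY y)
  δY-invY (ρ , s , u) = begin
    invW u ++ relWord ρ (flipS s) ++ u              ≡⟨ cong (λ r → invW u ++ r ++ u) (relWord-flipS ρ s) ⟩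
    invW u ++ invW (relWord ρ s) ++ u               ≡⟨ cong (λ v → invW u ++ invW (relWord ρ s) ++ v) (invW-involutive u) ⟨
    invW u ++ invW (relWord ρ s) ++ invW (invW u)   ≡⟨ cong (invW u ++_) (invW-++ (invW u) (relWord ρ s)) ⟨
    invW u ++ invW (invW u ++ relWord ρ s)          ≡⟨ invW-++ (invW u ++ relWord ρ s) u ⟨
    invW ((invW u ++ relWord ρ s) ++ u)             ≡⟨ cong invW (++-assoc (invW u) (relWord ρ s) u) ⟩
    invW (invW u ++ relWord ρ s ++ u)               ∎
    where open ≡-Reasoning

  invY-involutive : ∀ y → invY (invY y) ≡ y
  invY-involutive (ρ , s , u) = cong (λ t → ρ , t , u) (flipS-involutive s)

  invYs-++ : ∀ a b → invYs (a ++ b) ≡ invYs b ++ invYs a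
  invYs-++ = reverse-map-++ invY

  invYs-involutive : ∀ c → invYs (invYs c) ≡ c
  invYs-involutive = reverse-map-involutive invY invY-involutive

  δ-invYs-∷ : ∀ y c → δ (invYs (y ∷ c)) ≡ δ (invYs c) ++ δY (invY y)
  δ-invYs-∷ y c = begin
    δ (invYs (y ∷ c))                 ≡⟨ cong δ (invYs-++ (y ∷ []) c) ⟩
    δ (invYs c ++ invY y ∷ [])        ≡⟨ δ-++ (invYs c) (invY y ∷ []) ⟩
    δ (invYs c) ++ δY (invY y) ++ []  ≡⟨ cong (δ (invYs c) ++_) (++-identityʳ _) ⟩
    δ (invYs c) ++ δY (invY y)        ∎
    where open ≡-Reasoning

  δ-invYs : ∀ c → δ (invYs c) ≡ invW (δ c)
  δ-invYs []      = refl
  δ-invYs (y ∷ c) = begin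
    δ (invYs (y ∷ c))                 ≡⟨ δ-invYs-∷ y c ⟩
    δ (invYs c) ++ δY (invY y)        ≡⟨ cong₂ _++_ (δ-invYs c) (δY-invY y) ⟩
    invW (δ c) ++ invW (δY y)         ≡⟨ invW-++ (δY y) (δ c) ⟨
    invW (δY y ++ δ c)                ∎
    where open ≡-Reasoning

  act-identityʳ : ∀ c → act c [] ≡ c
  act-identityʳ []               = refl
  act-identityʳ ((ρ , s , u) ∷ c) = cong₂ _∷_ (cong (λ v → ρ , s , v) (++-identityʳ u)) (act-identityʳ c)

  act-act : ∀ c u v → act (act c u) v ≡ act c (u ++ v)
  act-act []               u v = refl
  act-act ((ρ , s , w) ∷ c) u v = cong₂ _∷_ (cong (λ t → ρ , s , t) (++-assoc w u v)) (act-act c u v)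

  act-invYs : ∀ c v → act (invYs c) v ≡ invYs (act c v)
  act-invYs c v = begin
    map (λ y → actY y v) (reverse (map invY c))   ≡⟨ reverse-map (λ y → actY y v) (map invY c) ⟩
    reverse (map (λ y → actY y v) (map invY c))   ≡⟨ cong reverse (map-∘ c) ⟨
    reverse (map (λ y → invY (actY y v)) c)       ≡⟨ cong reverse (map-∘ c) ⟩
    reverse (map invY (map (λ y → actY y v) c))   ∎
    where open ≡-Reasoning

  ≡⇒≈P : ∀ {a b} → a ≡ b → a ≈P b
  ≡⇒≈P refl = reflP

  ≈P-setoid : Setoid _ _
  ≈P-setoid = record
    { Carrier = Yseq ; _≈_ = _≈P_
    ; isEquivalence = record { refl = reflP ; sym = symP ; trans = transP } }

  module ≈P-Reasoning = SetoidReasoning ≈P-setoid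

  ≈P-congˡ : ∀ a {b b'} → b ≈P b' → (a ++ b) ≈P (a ++ b')
  ≈P-congˡ a {b} {b'} e = transP (≡⇒≈P (cong (a ++_) (sym (++-identityʳ b))))
                            (transP (ctxP a [] e) (≡⇒≈P (cong (a ++_) (++-identityʳ b'))))

  ≈P-congʳ : ∀ b {a a'} → a ≈P a' → (a ++ b) ≈P (a' ++ b)
  ≈P-congʳ b = ctxP [] b

  ≈P-cong : ∀ {a a' b b'} → a ≈P a' → b ≈P b' → (a ++ b) ≈P (a' ++ b')
  ≈P-cong {a' = a'} {b = b} e e' = transP (≈P-congʳ b e) (≈P-congˡ a' e')

  invYs-inverseʳ : ∀ c → (c ++ invYs c) ≈P []
  invYs-inverseʳ []      = reflP
  invYs-inverseʳ (y ∷ c) = begin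
    y ∷ c ++ invYs (y ∷ c)              ≡⟨ cong (λ c' → y ∷ c ++ c') (invYs-++ (y ∷ []) c) ⟩
    y ∷ c ++ invYs c ++ invY y ∷ []     ≡⟨ cong (y ∷_) (++-assoc c (invYs c) _) ⟨
    (y ∷ []) ++ (c ++ invYs c) ++ invY y ∷ [] ≈⟨ ctxP (y ∷ []) (invY y ∷ []) (invYs-inverseʳ c) ⟩
    y ∷ invY y ∷ []                     ≈⟨ cancelP y ⟩
    []                                  ∎
    where open ≈P-Reasoning

  invYs-inverseˡ : ∀ c → (invYs c ++ c) ≈P []
  invYs-inverseˡ c = transP (≡⇒≈P (cong (invYs c ++_) (sym (invYs-involutive c)))) (invYs-inverseʳ (invYs c))

  invYs-uniqueʳ : ∀ a b → (a ++ b) ≈P [] → b ≈P invYs a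
  invYs-uniqueʳ a b e = begin
    b                        ≈⟨ ≈P-congʳ b (invYs-inverseˡ a) ⟨
    (invYs a ++ a) ++ b      ≡⟨ ++-assoc (invYs a) a b ⟩
    invYs a ++ (a ++ b)      ≈⟨ ≈P-congˡ (invYs a) e ⟩
    invYs a ++ []            ≡⟨ ++-identityʳ (invYs a) ⟩
    invYs a                  ∎
    where open ≈P-Reasoning

  act-cong : ∀ c {u u'} → u ≈F u' → act c u ≈P act c u'
  act-cong []               e = reflP
  act-cong ((ρ , s , w) ∷ c) e = ≈P-cong (freeY ρ s (≈F-congˡ w e)) (act-cong c e)

  private
    peiffer′ : ∀ y z → (y ∷ z ∷ invY y ∷ []) ≈P (actY z (δY (invY y)) ∷ [])
    peiffer′ y z = subst (λ y′ → (y′ ∷ z ∷ invY y ∷ []) ≈P (actY z (δY (invY y)) ∷ []))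
                         (invY-involutive y) (peiffer (invY y) z)

    cancelP′ : ∀ y → (invY y ∷ y ∷ []) ≈P []
    cancelP′ y = subst (λ y′ → (invY y ∷ y′ ∷ []) ≈P []) (invY-involutive y) (cancelP (invY y))

  ∷-peiffer : ∀ y d → (y ∷ d) ≈P (act d (δY (invY y)) ++ y ∷ [])
  ∷-peiffer y []      = reflP
  ∷-peiffer y (z ∷ d) = begin
    y ∷ z ∷ d                               ≈⟨ ctxP (y ∷ z ∷ []) d (cancelP′ y) ⟨
    y ∷ z ∷ invY y ∷ y ∷ d                  ≈⟨ ctxP [] (y ∷ d) (peiffer′ y z) ⟩
    actY z v ∷ y ∷ d                        ≈⟨ ≈P-congˡ (actY z v ∷ []) (∷-peiffer y d) ⟩
    actY z v ∷ act d v ++ y ∷ []            ∎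
    where
    open ≈P-Reasoning
    v = δY (invY y)

  ++-peiffer : ∀ p d → (p ++ d) ≈P (act d (δ (invYs p)) ++ p)
  ++-peiffer []      d = ≡⇒≈P (sym (trans (++-identityʳ _) (act-identityʳ d)))
  ++-peiffer (y ∷ p) d = begin
    y ∷ p ++ d                              ≈⟨ ≈P-congˡ (y ∷ []) (++-peiffer p d) ⟩
    (y ∷ []) ++ act d v ++ p                ≡⟨ ++-assoc (y ∷ []) (act d v) p ⟨
    (y ∷ act d v) ++ p                      ≈⟨ ≈P-congʳ p (∷-peiffer y (act d v)) ⟩
    (act (act d v) (δY (invY y)) ++ y ∷ []) ++ p ≡⟨ ++-assoc (act (act d v) (δY (invY y))) (y ∷ []) p ⟩
    act (act d v) (δY (invY y)) ++ y ∷ p   ≡⟨ cong (_++ y ∷ p) (act-act d v (δY (invY y))) ⟩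
    act d (v ++ δY (invY y)) ++ y ∷ p      ≡⟨ cong (λ u → act d u ++ y ∷ p) (δ-invYs-∷ y p) ⟨
    act d (δ (invYs (y ∷ p))) ++ y ∷ p     ∎
    where
    open ≈P-Reasoning
    v = δ (invYs p)

  conjugate≈act : ∀ a p → (a ++ p ++ invYs a) ≈P act p (δ (invYs a))
  conjugate≈act a p = begin
    a ++ p ++ invYs a                       ≡⟨ ++-assoc a p (invYs a) ⟨
    (a ++ p) ++ invYs a                     ≈⟨ ≈P-congʳ (invYs a) (++-peiffer a p) ⟩
    (act p (δ (invYs a)) ++ a) ++ invYs a   ≡⟨ ++-assoc (act p _) a (invYs a) ⟩
    act p (δ (invYs a)) ++ a ++ invYs a     ≈⟨ ≈P-congˡ (act p _) (invYs-inverseʳ a) ⟩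
    act p (δ (invYs a)) ++ []               ≡⟨ ++-identityʳ _ ⟩
    act p (δ (invYs a))                     ∎
    where open ≈P-Reasoning

  InPi2-invYs : ∀ c → InPi2 c → InPi2 (invYs c)
  InPi2-invYs c δc≈[] = transF (≡⇒≈F (δ-invYs c)) (invW-cong δc≈[])

  InPi2-act : ∀ c v → InPi2 c → InPi2 (act c v)
  InPi2-act c v δc≈[] = begin
    δ (act c v)            ≈⟨ δ-act c v ⟩
    invW v ++ δ c ++ v     ≈⟨ ≈F-congˡ (invW v) (≈F-congʳ v δc≈[]) ⟩
    invW v ++ v            ≈⟨ invW-inverseˡ v ⟩
    []                     ∎
    where open ≈F-Reasoning

  InPi2-central : ∀ {t} d → InPi2 t → (t ++ d) ≈P (d ++ t)
  InPi2-central {t} d δt≈[] = begin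
    t ++ d                          ≈⟨ ++-peiffer t d ⟩
    act d (δ (invYs t)) ++ t        ≈⟨ ≈P-congʳ t (act-cong d (InPi2-invYs t δt≈[])) ⟩
    act d [] ++ t                   ≡⟨ cong (_++ t) (act-identityʳ d) ⟩
    d ++ t                          ∎
    where open ≈P-Reasoning

  InPi2-signedYs : ∀ c s → InPi2 c → InPi2 (signedYs c s)
  InPi2-signedYs c pos = id
  InPi2-signedYs c neg = InPi2-invYs c

  invYs-act-signedYs : ∀ c s v → invYs (act (signedYs c s) v) ≡ act (signedYs c (flipS s)) v
  invYs-act-signedYs c pos v = sym (act-invYs c v)
  invYs-act-signedYs c neg v = begin
    invYs (act (invYs c) v)     ≡⟨ cong invYs (act-invYs c v) ⟩
    invYs (invYs (act c v))     ≡⟨ invYs-involutive (act c v) ⟩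
    act c v                     ∎
    where open ≡-Reasoning

  module _ {I : Set} (ι : I → Yseq) where

    generated-[] : GeneratedBy ι []
    generated-[] = [] , reflP

    generated-++ : ∀ {a b} → GeneratedBy ι a → GeneratedBy ι b → GeneratedBy ι (a ++ b)
    generated-++ (gs , a≈) (hs , b≈) = gs ++ hs , transP (≈P-cong a≈ b≈) (≡⇒≈P (sym (concatMap-++ _ gs hs)))

    generated-signed : ∀ i u s → GeneratedBy ι (act (signedYs (ι i) s) u)
    generated-signed i u s = (i , u , s) ∷ [] , ≡⇒≈P (sym (++-identityʳ _))

    generated-resp : ∀ {a b} → a ≈P b → GeneratedBy ι b → GeneratedBy ι a
    generated-resp a≈b (gs , b≈) = gs , transP a≈b b≈

module LoggedReduction (X R : Set) (ω : R → Word X) (𝓛 : List (Pres.Rule X R ω)) where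
  open Pres X R ω
  open Logged 𝓛
  open FreeCrossedModule X R ω

  reduces-irreducible : ∀ {z L z' L'} → Reduces z L z' L' → Irreducible z'
  reduces-irreducible (done z-irr)  = z-irr
  reduces-irreducible (step _ rest) = reduces-irreducible rest

  reduces-steps : ∀ {z L z' L'} → Reduces z L z' L' → Star Step z z'
  reduces-steps (done _) = ε
  reduces-steps (step {l} {c} {r} {u} {v} rule∈ rest) =
    ((l , c , r) , rule∈ , u , v , refl , refl) ◅ reduces-steps rest

  logged-rewrite : ∀ u {l} c {r} → l ≈F (δ c ++ r) → (u ++ l) ≈F (δ (act c (invW u)) ++ u ++ r)
  logged-rewrite u {l} c {r} l≈ = begin
    u ++ l                                      ≈⟨ ≈F-congˡ u l≈ ⟩
    u ++ δ c ++ r                               ≡⟨ solve (++-monoid (Lit X)) ⟩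
    (u ++ δ c) ++ [] ++ r                       ≈⟨ ≈F-delete (u ++ δ c) r (invW-inverseˡ u) ⟨
    (u ++ δ c) ++ (invW u ++ u) ++ r            ≡⟨ solve (++-monoid (Lit X)) ⟩
    (u ++ δ c ++ invW u) ++ u ++ r              ≡⟨ cong (λ u′ → (u′ ++ δ c ++ invW u) ++ u ++ r) (invW-involutive u) ⟨
    (invW (invW u) ++ δ c ++ invW u) ++ u ++ r  ≈⟨ ≈F-congʳ (u ++ r) (δ-act c (invW u)) ⟨
    δ (act c (invW u)) ++ u ++ r                ∎
    where open ≈F-Reasoning

  reduces-log : (∀ l c r → (l , c , r) ∈ 𝓛 → l ≈F (δ c ++ r)) →
                ∀ {z L z' L'} → Reduces z L z' L' → (δ L ++ z) ≈F (δ L' ++ z')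
  reduces-log rules-logged (done _) = reflF
  reduces-log rules-logged (step {l} {c} {r} {u} {v} {L} rule∈ rest) = transF (begin
    δ L ++ u ++ l ++ v                              ≡⟨ cong (δ L ++_) (++-assoc u l v) ⟨
    δ L ++ (u ++ l) ++ v
      ≈⟨ ≈F-congˡ (δ L) (≈F-congʳ v (logged-rewrite u c (rules-logged l c r rule∈))) ⟩
    δ L ++ (δ (act c (invW u)) ++ u ++ r) ++ v      ≡⟨ solve (++-monoid (Lit X)) ⟩
    (δ L ++ δ (act c (invW u))) ++ u ++ r ++ v      ≡⟨ cong (_++ u ++ r ++ v) (δ-++ L (act c (invW u))) ⟨
    δ (L ++ act c (invW u)) ++ u ++ r ++ v          ∎) (reduces-log rules-logged rest)
    where open ≈F-Reasoning

module CompleteRewriting (X R : Set) (ω : R → Word X) (𝓛 : List (Pres.Rule X R ω))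
  (complete : Pres.Logged.IsCompleteLoggedRewriteSystem X R ω 𝓛)
  (nf : Word X → Word X) (isNF : Pres.Logged.IsNormalForm X R ω 𝓛 nf) where
  open Pres X R ω
  open Logged 𝓛
  open WithNF nf
  open FreeCrossedModule X R ω
  open LoggedReduction X R ω 𝓛
  open FreeReduction

  step⇒~N : ∀ {w w'} → Step w w' → w ~N w'
  step⇒~N s = Equivalence.to (proj₁ (proj₁ complete) _ _) (fwd s ◅ ε)

  steps⇒~N : ∀ {w w'} → Star Step w w' → w ~N w'
  steps⇒~N ε       = freeN reflF
  steps⇒~N (s ◅ r) = transN (step⇒~N s) (steps⇒~N r)

  step-confluent : IsConfluent Step
  step-confluent p q = proj₂ (proj₂ complete) _ _ _ p q

  private
    ~N⇒convertible : ∀ {w w'} → w ~N w' → w ↔* w'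
    ~N⇒convertible = Equivalence.from (proj₁ (proj₁ complete) _ _)

    irreducible⇒normal : ∀ {w} → Irreducible w → IsNormal Step w
    irreducible⇒normal w-irr (w' , s) = w-irr w' s

  irreducible-unique : ∀ {a b} → Irreducible a → Irreducible b → a ~N b → a ≡ b
  irreducible-unique a-irr b-irr a~b =
    conf⇒unf step-confluent (irreducible⇒normal a-irr) (irreducible⇒normal b-irr) (~N⇒convertible a~b)

  reduces-to-irreducible : ∀ {w z} → Irreducible z → w ~N z → Star Step w z
  reduces-to-irreducible z-irr w~z = conf⇒nf step-confluent (irreducible⇒normal z-irr) (~N⇒convertible w~z)

  -- A rule with empty left-hand side would rewrite w to r ++ w forever.
  []-irreducible : Irreducible []
  []-irreducible _ (rule@(l , _ , r) , rule∈ , u , v , []≡ , _) = diverges [] (proj₁ (proj₂ complete) [])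
    where
    l≡[] : l ≡ []
    l≡[] = ++-conicalˡ l v (++-conicalʳ u (l ++ v) (sym []≡))
    diverges : ∀ w → Acc (λ w' w → Step w w') w → ⊥
    diverges w (acc rs) = diverges (r ++ w) (rs (rule , rule∈ , [] , w , cong (_++ w) (sym l≡[]) , refl))

  irreducible-infix : ∀ p q {w} → Irreducible (p ++ w ++ q) → Irreducible w
  irreducible-infix p q pwq-irr _ (rule , rule∈ , u , v , refl , refl) =
    pwq-irr _ (rule , rule∈ , p ++ u , v ++ q , solve (++-monoid (Lit X)) , refl)

  irreducible⇒freelyReduced : ∀ {w} → Irreducible w → FreelyReduced w
  irreducible⇒freelyReduced w-irr (_ , u , v , a , refl , _)
    with s ◅ _ ← reduces-to-irreducible []-irreducible (freeN (cancel [] [] a)) =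
    irreducible-infix u v w-irr _ s

  nf-irreducible : ∀ w → Irreducible (nf w)
  nf-irreducible w = proj₁ (isNF w)

  irreducible-or-step : ∀ w → Irreducible w ⊎ ∃ (Step w)
  irreducible-or-step w = first-step (reduces-to-irreducible (nf-irreducible w) (symN (proj₂ (isNF w)))) (nf-irreducible w)
    where
    first-step : ∀ {z} → Star Step w z → Irreducible z → Irreducible w ⊎ ∃ (Step w)
    first-step ε       z-irr = inj₁ z-irr
    first-step (s ◅ _) _     = inj₂ (_ , s)

  move-irreducible : ∀ g a → Irreducible (move g a)
  move-irreducible g a = nf-irreducible (g ∷ʳ a)

  move~N : ∀ g a → move g a ~N (g ∷ʳ a)
  move~N g a = proj₂ (isNF (g ∷ʳ a))

  move-invLit : ∀ {g} → Irreducible g → ∀ a → move (move g a) (invLit a) ≡ g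
  move-invLit {g} g-irr a = irreducible-unique (move-irreducible _ _) g-irr (begin
    move (move g a) (invLit a)   ≈⟨ move~N (move g a) (invLit a) ⟩
    move g a ∷ʳ invLit a         ≈⟨ ~N-congʳ (invLit a ∷ []) (move~N g a) ⟩
    (g ∷ʳ a) ∷ʳ invLit a         ≈⟨ freeN (∷ʳ-invLit-cancel g a) ⟩
    g                            ∎)
    where open ~N-Reasoning

  target : Word X → Word X → Word X
  target = foldl move

  target-irreducible : ∀ {g} → Irreducible g → ∀ w → Irreducible (target g w)
  target-irreducible g-irr []      = g-irr
  target-irreducible _     (a ∷ w) = target-irreducible (move-irreducible _ a) w

  target~N : ∀ g w → target g w ~N (g ++ w)
  target~N g []      = ≡⇒~N (sym (++-identityʳ g))
  target~N g (a ∷ w) = begin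
    target (move g a) w    ≈⟨ target~N (move g a) w ⟩
    move g a ++ w          ≈⟨ ~N-congʳ w (move~N g a) ⟩
    (g ∷ʳ a) ++ w          ≡⟨ ++-assoc g (a ∷ []) w ⟩
    g ++ a ∷ w             ∎
    where open ~N-Reasoning

  target-loop : ∀ {g} → Irreducible g → ∀ {w} → w ~N [] → target g w ≡ g
  target-loop {g} g-irr {w} w~[] = irreducible-unique (target-irreducible g-irr w) g-irr (begin
    target g w   ≈⟨ target~N g w ⟩
    g ++ w       ≈⟨ ~N-congˡ g w~[] ⟩
    g ++ []      ≡⟨ ++-identityʳ g ⟩
    g            ∎)
    where open ~N-Reasoning

  edgeWord≈F[]⇔ : ∀ g x → (edgeWord g x ≈F []) ⇔ ((g ∷ʳ (pos , x)) ≈F move g (pos , x))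
  edgeWord≈F[]⇔ g x = mk⇔
    (λ trivial → ++-invW≈F[]⇒≈F (subst (_≈F []) reassoc trivial))
    (λ gx≈n → subst (_≈F []) (sym reassoc) (≈F⇒++-invW≈F[] gx≈n))
    where
    reassoc : edgeWord g x ≡ (g ∷ʳ (pos , x)) ++ invW (move g (pos , x))
    reassoc = sym (++-assoc g _ _)

  edgeWord~N[] : ∀ g x → edgeWord g x ~N []
  edgeWord~N[] g x = begin
    edgeWord g x          ≡⟨ ++-assoc g (x⁺ ∷ []) (invW n) ⟨
    (g ∷ʳ x⁺) ++ invW n   ≈⟨ ~N-congʳ (invW n) (move~N g x⁺) ⟨
    n ++ invW n           ≈⟨ freeN (invW-inverseʳ n) ⟩
    []                    ∎
    where
    open ~N-Reasoning
    x⁺ = (pos , x)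
    n = move g x⁺

  -- If the edge word were freely trivial, g x⁺ would be freely equal to the irreducible n = move g x⁺.
  -- Now g does not end in x⁻ (otherwise n x⁻ = g would be irreducible), so g x⁺ is freely reduced and
  -- hence equal to n, which contradicts the reducibility of g x⁺.
  private
    nontrivial-edge : ∀ {g} x → Irreducible g →
      ∃ (Step (g ∷ʳ (pos , x))) → ∃ (Step (move g (pos , x) ∷ʳ (neg , x))) → ¬ edgeWord g x ≈F []
    nontrivial-edge {g} x g-irr (_ , gx-step) (_ , nx-step) trivial =
      move-irreducible g x⁺ _ (subst (λ w → Step w _) gx≡n gx-step)
      where
      x⁺ x⁻ : Lit X
      x⁺ = (pos , x)
      x⁻ = (neg , x)
      n = move g x⁺
      not-cancelling : ∀ g' → g ≢ g' ∷ʳ x⁻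
      not-cancelling g' g≡ = g-irr _ (subst (λ w → Step w _) (trans (cong (_∷ʳ x⁻) n≡g') (sym g≡)) nx-step)
        where
        n≡g' : n ≡ g'
        n≡g' = irreducible-unique (move-irreducible g x⁺)
          (irreducible-infix [] (x⁻ ∷ []) (subst Irreducible g≡ g-irr))
          (transN (move~N g x⁺) (transN (≡⇒~N (cong (_∷ʳ x⁺) g≡)) (freeN (∷ʳ-invLit-cancel g' x⁻))))
      gx≡n : g ∷ʳ x⁺ ≡ n
      gx≡n = freelyReduced-unique
        (freelyReduced-∷ʳ x⁺ (irreducible⇒freelyReduced g-irr) not-cancelling)
        (irreducible⇒freelyReduced (move-irreducible g x⁺))
        (Equivalence.to (edgeWord≈F[]⇔ g x) trivial)

  -- X has no decidable equality, so free triviality of an edge word is decided through the rewriting system.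
  edgeWord-trivial? : ∀ {g} → Irreducible g → ∀ x → edgeWord g x ≈F [] ⊎ ¬ edgeWord g x ≈F []
  edgeWord-trivial? {g} g-irr x with irreducible-or-step (g ∷ʳ (pos , x))
  ... | inj₁ gx-irr = inj₁ (Equivalence.from (edgeWord≈F[]⇔ g x)
          (≡⇒≈F (irreducible-unique gx-irr (move-irreducible g (pos , x)) (symN (move~N g (pos , x))))))
  ... | inj₂ gx-step with irreducible-or-step (move g (pos , x) ∷ʳ (neg , x))
  ...   | inj₂ nx-step = inj₂ (nontrivial-edge x g-irr gx-step nx-step)
  ...   | inj₁ nx-irr  = inj₁ (Equivalence.from (edgeWord≈F[]⇔ g x) (begin
          g ∷ʳ (pos , x)                              ≡⟨ cong (_∷ʳ (pos , x)) nx≡g ⟨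
          (move g (pos , x) ∷ʳ (neg , x)) ∷ʳ (pos , x) ≈⟨ ∷ʳ-invLit-cancel (move g (pos , x)) (neg , x) ⟩
          move g (pos , x)                            ∎))
    where
    open ≈F-Reasoning
    nx≡g : move g (pos , x) ∷ʳ (neg , x) ≡ g
    nx≡g = irreducible-unique nx-irr g-irr
      (transN (~N-congʳ ((neg , x) ∷ []) (move~N g (pos , x))) (freeN (∷ʳ-invLit-cancel g (pos , x))))

  module K1 (kk : Word X → X → Yseq) (isK1 : IsK1Choice kk) where

    δ-kk : ∀ g → Irreducible g → ∀ x → δ (kk g x) ≈F edgeWord g x
    δ-kk g g-irr x with edgeWord-trivial? g-irr x
    ... | inj₁ trivial rewrite proj₁ (isK1 g g-irr x) trivial = symF trivial
    ... | inj₂ nontrivial with (z , reduction) ← proj₂ (isK1 g g-irr x) nontrivial = begin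
      δ (kk g x)          ≡⟨ ++-identityʳ _ ⟨
      δ (kk g x) ++ []    ≡⟨ cong (δ (kk g x) ++_) z≡[] ⟨
      δ (kk g x) ++ z     ≈⟨ reduces-log (proj₂ (proj₁ complete)) reduction ⟨
      edgeWord g x        ∎
      where
      open ≈F-Reasoning
      z≡[] : z ≡ []
      z≡[] = irreducible-unique (reduces-irreducible reduction) []-irreducible
        (transN (symN (steps⇒~N (reduces-steps reduction))) (edgeWord~N[] g x))

    k1 : Word X → Word X → Yseq
    k1 = k1Path kk

    k1Letter : Word X → Lit X → Yseq
    k1Letter g (pos , x) = kk g x
    k1Letter g (neg , x) = invYs (kk (move g (neg , x)) x)

    k1Path-∷ : ∀ g a w → k1 g (a ∷ w) ≡ k1Letter g a ++ k1 (move g a) w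
    k1Path-∷ g (pos , x) w = refl
    k1Path-∷ g (neg , x) w = refl

    δ-k1Letter : ∀ {g} → Irreducible g → ∀ a → δ (k1Letter g a) ≈F (g ++ a ∷ invW (move g a))
    δ-k1Letter {g} g-irr (pos , x) = δ-kk g g-irr x
    δ-k1Letter {g} g-irr (neg , x) = begin
      δ (invYs (kk m x))                               ≡⟨ δ-invYs (kk m x) ⟩
      invW (δ (kk m x))                                ≈⟨ invW-cong (δ-kk m (move-irreducible g (neg , x)) x) ⟩
      invW (m ++ (pos , x) ∷ invW (move m (pos , x)))
        ≡⟨ cong (λ h → invW (m ++ (pos , x) ∷ invW h)) (move-invLit g-irr (neg , x)) ⟩
      invW (m ++ (pos , x) ∷ invW g)                   ≡⟨ invW-∷-invW m (pos , x) g ⟩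
      g ++ (neg , x) ∷ invW m                          ∎
      where
      open ≈F-Reasoning
      m = move g (neg , x)

    δ-k1Path : ∀ {g} → Irreducible g → ∀ w → δ (k1 g w) ≈F (g ++ w ++ invW (target g w))
    δ-k1Path {g} g-irr []      = symF (invW-inverseʳ g)
    δ-k1Path {g} g-irr (a ∷ w) = begin
      δ (k1 g (a ∷ w))                                   ≡⟨ cong δ (k1Path-∷ g a w) ⟩
      δ (k1Letter g a ++ k1 m w)                         ≡⟨ δ-++ (k1Letter g a) (k1 m w) ⟩
      δ (k1Letter g a) ++ δ (k1 m w)
        ≈⟨ ≈F-cong (δ-k1Letter g-irr a) (δ-k1Path (move-irreducible g a) w) ⟩
      (g ++ (a ∷ []) ++ invW m) ++ m ++ w ++ invW e      ≡⟨ solve (++-monoid (Lit X)) ⟩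
      (g ++ a ∷ []) ++ (invW m ++ m) ++ w ++ invW e      ≈⟨ ≈F-delete (g ++ a ∷ []) (w ++ invW e) (invW-inverseˡ m) ⟩
      (g ++ a ∷ []) ++ w ++ invW e                       ≡⟨ ++-assoc g (a ∷ []) (w ++ invW e) ⟩
      g ++ a ∷ w ++ invW e                               ∎
      where
      open ≈F-Reasoning
      m = move g a
      e = target m w

    k1Path-++ : ∀ g u w → k1 g (u ++ w) ≡ k1 g u ++ k1 (target g u) w
    k1Path-++ g []      w = refl
    k1Path-++ g (a ∷ u) w = begin
      k1 g (a ∷ u ++ w)                                     ≡⟨ k1Path-∷ g a (u ++ w) ⟩
      k1Letter g a ++ k1 (move g a) (u ++ w)                ≡⟨ cong (k1Letter g a ++_) (k1Path-++ (move g a) u w) ⟩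
      k1Letter g a ++ k1 (move g a) u ++ k1 (target g (a ∷ u)) w ≡⟨ ++-assoc (k1Letter g a) _ _ ⟨
      (k1Letter g a ++ k1 (move g a) u) ++ k1 (target g (a ∷ u)) w ≡⟨ cong (_++ k1 (target g (a ∷ u)) w) (k1Path-∷ g a u) ⟨
      k1 g (a ∷ u) ++ k1 (target g (a ∷ u)) w               ∎
      where open ≡-Reasoning

    k1Letter-invLit : ∀ {g} → Irreducible g → ∀ a → k1Letter (move g a) (invLit a) ≡ invYs (k1Letter g a)
    k1Letter-invLit g-irr (pos , x) = cong (λ h → invYs (kk h x)) (move-invLit g-irr (pos , x))
    k1Letter-invLit g-irr (neg , x) = sym (invYs-involutive _)

    k1Path-cancel : ∀ {g} → Irreducible g → ∀ a v → k1 g (a ∷ invLit a ∷ v) ≈P k1 g v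
    k1Path-cancel {g} g-irr a v = begin
      k1 g (a ∷ invLit a ∷ v)                                ≡⟨ k1Path-∷ g a _ ⟩
      L ++ k1 m (invLit a ∷ v)                               ≡⟨ cong (L ++_) (k1Path-∷ m (invLit a) v) ⟩
      L ++ k1Letter m (invLit a) ++ k1 (move m (invLit a)) v
        ≡⟨ cong₂ (λ L′ h → L ++ L′ ++ k1 h v) (k1Letter-invLit g-irr a) (move-invLit g-irr a) ⟩
      L ++ invYs L ++ k1 g v                                 ≡⟨ ++-assoc L (invYs L) (k1 g v) ⟨
      (L ++ invYs L) ++ k1 g v                               ≈⟨ ≈P-congʳ (k1 g v) (invYs-inverseʳ L) ⟩
      k1 g v                                                 ∎
      where
      open ≈P-Reasoning
      L = k1Letter g a
      m = move g a

    k1Path-cong : ∀ {g} → Irreducible g → ∀ {w w'} → w ≈F w' → k1 g w ≈P k1 g w'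
    k1Path-cong {g} g-irr (cancel u v a) = begin
      k1 g (u ++ a ∷ invLit a ∷ v)                  ≡⟨ k1Path-++ g u _ ⟩
      k1 g u ++ k1 (target g u) (a ∷ invLit a ∷ v)
        ≈⟨ ≈P-congˡ (k1 g u) (k1Path-cancel (target-irreducible g-irr u) a v) ⟩
      k1 g u ++ k1 (target g u) v                   ≡⟨ k1Path-++ g u v ⟨
      k1 g (u ++ v)                                 ∎
      where open ≈P-Reasoning
    k1Path-cong g-irr reflF         = reflP
    k1Path-cong g-irr (symF e)      = symP (k1Path-cong g-irr e)
    k1Path-cong g-irr (transF e e') = transP (k1Path-cong g-irr e) (k1Path-cong g-irr e')

    k1Path-invW : ∀ {g} → Irreducible g → ∀ w → k1 (target g w) (invW w) ≈P invYs (k1 g w)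
    k1Path-invW {g} g-irr w = invYs-uniqueʳ (k1 g w) _
      (transP (≡⇒≈P (sym (k1Path-++ g w (invW w)))) (k1Path-cong g-irr (invW-inverseʳ w)))

    relatorAt : Word X → R → Ysym
    relatorAt h ρ = (ρ , pos , invW h)

    δ-k1-relator : ∀ {h} → Irreducible h → ∀ ρ → δ (k1 h (ω ρ)) ≈F δY (relatorAt h ρ)
    δ-k1-relator {h} h-irr ρ = begin
      δ (k1 h (ω ρ))                          ≈⟨ δ-k1Path h-irr (ω ρ) ⟩
      h ++ ω ρ ++ invW (target h (ω ρ))
        ≡⟨ cong (λ g → h ++ ω ρ ++ invW g) (target-loop h-irr (relWord~N[] ρ pos)) ⟩
      h ++ ω ρ ++ invW h                      ≡⟨ cong (_++ ω ρ ++ invW h) (invW-involutive h) ⟨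
      invW (invW h) ++ ω ρ ++ invW h          ∎
      where open ≈F-Reasoning

    iota-InPi2 : ∀ i → InPi2 (iota kk i)
    iota-InPi2 ((h , h-irr) , ρ) = begin
      δY (invY z) ++ δ (k1 h (ω ρ))   ≈⟨ ≈F-cong (≡⇒≈F (δY-invY z)) (δ-k1-relator h-irr ρ) ⟩
      invW (δY z) ++ δY z             ≈⟨ invW-inverseˡ (δY z) ⟩
      []                              ∎
      where
      open ≈F-Reasoning
      z = relatorAt h ρ

    k1-relWord : ∀ {h} (h-irr : Irreducible h) ρ s →
                 k1 h (relWord ρ s) ≈P ((ρ , s , invW h) ∷ signedYs (iota kk ((h , h-irr) , ρ)) s)
    k1-relWord {h} h-irr ρ pos = ctxP [] (k1 h (ω ρ)) (symP (cancelP (relatorAt h ρ)))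
    k1-relWord {h} h-irr ρ neg = begin
      k1 h (invW (ω ρ))                       ≡⟨ cong (λ g → k1 g (invW (ω ρ))) (target-loop h-irr (relWord~N[] ρ pos)) ⟨
      k1 (target h (ω ρ)) (invW (ω ρ))        ≈⟨ k1Path-invW h-irr (ω ρ) ⟩
      invYs K                                 ≡⟨ ++-identityʳ (invYs K) ⟨
      invYs K ++ []                           ≈⟨ ≈P-congˡ (invYs K) (cancelP z) ⟨
      invYs K ++ z ∷ invY z ∷ []              ≡⟨ ++-assoc (invYs K) (z ∷ []) _ ⟨
      (invYs K ++ z ∷ []) ++ invY z ∷ []      ≡⟨ cong (_++ invY z ∷ []) (invYs-++ (invY z ∷ []) K) ⟨
      invYs ι ++ invY z ∷ []
        ≈⟨ InPi2-central (invY z ∷ []) (InPi2-invYs ι (iota-InPi2 ((h , h-irr) , ρ))) ⟩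
      invY z ∷ invYs ι                        ∎
      where
      open ≈P-Reasoning
      z = relatorAt h ρ
      K = k1 h (ω ρ)
      ι = iota kk ((h , h-irr) , ρ)

    k1-conjugate : ∀ u {w} → w ~N [] →
                   k1 [] (invW u ++ w ++ u) ≈P (k1 [] (invW u) ++ k1 (target [] (invW u)) w ++ invYs (k1 [] (invW u)))
    k1-conjugate u {w} w~[] = begin
      k1 [] (invW u ++ w ++ u)              ≡⟨ k1Path-++ [] (invW u) (w ++ u) ⟩
      A ++ k1 h (w ++ u)                    ≡⟨ cong (A ++_) (k1Path-++ h w u) ⟩
      A ++ k1 h w ++ k1 (target h w) u      ≡⟨ cong (λ g → A ++ k1 h w ++ k1 g u) (target-loop h-irr w~[]) ⟩
      A ++ k1 h w ++ k1 h u                 ≈⟨ ≈P-congˡ A (≈P-congˡ (k1 h w) back) ⟩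
      A ++ k1 h w ++ invYs A                ∎
      where
      open ≈P-Reasoning
      A = k1 [] (invW u)
      h = target [] (invW u)
      h-irr = target-irreducible []-irreducible (invW u)
      back : k1 h u ≈P invYs A
      back = invYs-uniqueʳ A (k1 h u)
        (transP (≡⇒≈P (sym (k1Path-++ [] (invW u) u))) (k1Path-cong []-irreducible (invW-inverseˡ u)))

    δ-invYs-k1 : ∀ u → δ (invYs (k1 [] (invW u))) ≈F (target [] (invW u) ++ u)
    δ-invYs-k1 u = begin
      δ (invYs (k1 [] (invW u)))        ≡⟨ δ-invYs (k1 [] (invW u)) ⟩
      invW (δ (k1 [] (invW u)))         ≈⟨ invW-cong (δ-k1Path []-irreducible (invW u)) ⟩
      invW (invW u ++ invW h)           ≡⟨ invW-++ (invW u) (invW h) ⟩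
      invW (invW h) ++ invW (invW u)    ≡⟨ cong₂ _++_ (invW-involutive h) (invW-involutive u) ⟩
      h ++ u                            ∎
      where
      open ≈F-Reasoning
      h = target [] (invW u)

    iotaIndex : Word X → R → Σ (Word X) Irreducible × R
    iotaIndex u ρ = (target [] (invW u) , target-irreducible []-irreducible (invW u)) , ρ

    k1-δY : ∀ ρ s u → k1 [] (δY (ρ , s , u)) ≈P
            ((ρ , s , u) ∷ act (signedYs (iota kk (iotaIndex u ρ)) s) (target [] (invW u) ++ u))
    k1-δY ρ s u = begin
      k1 [] (invW u ++ relWord ρ s ++ u)    ≈⟨ k1-conjugate u (relWord~N[] ρ s) ⟩
      A ++ k1 h (relWord ρ s) ++ invYs A    ≈⟨ ≈P-congˡ A (≈P-congʳ (invYs A) (k1-relWord h-irr ρ s)) ⟩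
      A ++ Q ++ invYs A                     ≈⟨ conjugate≈act A Q ⟩
      act Q (δ (invYs A))                   ≈⟨ act-cong Q (δ-invYs-k1 u) ⟩
      (ρ , s , invW h ++ h ++ u) ∷ act T (h ++ u) ≈⟨ ≈P-congʳ (act T (h ++ u)) (freeY ρ s invW-h-h-u≈u) ⟩
      (ρ , s , u) ∷ act T (h ++ u)          ∎
      where
      open ≈P-Reasoning
      A = k1 [] (invW u)
      h = target [] (invW u)
      h-irr = target-irreducible []-irreducible (invW u)
      T = signedYs (iota kk (iotaIndex u ρ)) s
      Q = (ρ , s , invW h) ∷ T
      invW-h-h-u≈u : (invW h ++ h ++ u) ≈F u
      invW-h-h-u≈u = transF (≡⇒≈F (sym (++-assoc (invW h) h u))) (≈F-delete [] u (invW-inverseˡ h))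

    decomposition-Ysym : ∀ y → ∃ λ t → GeneratedBy (iota kk) t × InPi2 t × (y ∷ []) ≈P (k1 [] (δY y) ++ t)
    decomposition-Ysym (ρ , s , u) =
      act (signedYs ι (flipS s)) v ,
      generated-signed (iota kk) (iotaIndex u ρ) v (flipS s) ,
      InPi2-act (signedYs ι (flipS s)) v (InPi2-signedYs ι (flipS s) (iota-InPi2 (iotaIndex u ρ))) ,
      (begin
        y ∷ []                                  ≈⟨ ≈P-congˡ (y ∷ []) (invYs-inverseʳ T) ⟨
        (y ∷ T) ++ invYs T                      ≈⟨ ≈P-congʳ (invYs T) (k1-δY ρ s u) ⟨
        k1 [] (δY y) ++ invYs T                 ≡⟨ cong (k1 [] (δY y) ++_) (invYs-act-signedYs ι s v) ⟩
        k1 [] (δY y) ++ act (signedYs ι (flipS s)) v ∎)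
      where
      open ≈P-Reasoning
      y = (ρ , s , u)
      ι = iota kk (iotaIndex u ρ)
      v = target [] (invW u) ++ u
      T = act (signedYs ι s) v

    decomposition : ∀ c → ∃ λ a → GeneratedBy (iota kk) a × c ≈P (k1 [] (δ c) ++ a)
    decomposition []      = [] , generated-[] (iota kk) , reflP
    decomposition (y ∷ c)
      with (t , t-gen , t-π₂ , y≈) ← decomposition-Ysym y | (a , a-gen , c≈) ← decomposition c =
      t ++ a , generated-++ (iota kk) t-gen a-gen , (begin
        (y ∷ []) ++ c                           ≈⟨ ≈P-cong y≈ c≈ ⟩
        (Ky ++ t) ++ Kc ++ a                    ≡⟨ solve (++-monoid Ysym) ⟩
        Ky ++ (t ++ Kc) ++ a                    ≈⟨ ≈P-congˡ Ky (≈P-congʳ a (InPi2-central Kc t-π₂)) ⟩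
        Ky ++ (Kc ++ t) ++ a                    ≡⟨ solve (++-monoid Ysym) ⟩
        (Ky ++ Kc) ++ t ++ a                    ≡⟨ cong (_++ t ++ a) k1-δ-∷ ⟨
        k1 [] (δY y ++ δ c) ++ t ++ a           ∎)
      where
      open ≈P-Reasoning
      Ky = k1 [] (δY y)
      Kc = k1 [] (δ c)
      k1-δ-∷ : k1 [] (δY y ++ δ c) ≡ Ky ++ Kc
      k1-δ-∷ = trans (k1Path-++ [] (δY y) (δ c))
                     (cong (λ g → Ky ++ k1 g (δ c)) (target-loop []-irreducible (δY~N[] y)))

    InPi2⇒generated : ∀ c → InPi2 c → GeneratedBy (iota kk) c
    InPi2⇒generated c δc≈[] with (a , a-gen , c≈) ← decomposition c =
      generated-resp (iota kk) (transP c≈ (≈P-congʳ a (k1Path-cong []-irreducible δc≈[]))) a-gen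

mainTheorem1 : (X R : Set) (ω : R → Word X) (𝓛 : List (Pres.Rule X R ω)) →
    Pres.Logged.IsCompleteLoggedRewriteSystem X R ω 𝓛 →
    (nf : Word X → Word X) → Pres.Logged.IsNormalForm X R ω 𝓛 nf →
    (kk : Word X → X → Pres.Yseq X R ω) →
    Pres.Logged.WithNF.IsK1Choice X R ω 𝓛 nf kk →
    ((g : Word X) → Pres.Logged.Irreducible X R ω 𝓛 g → (x : X) →
        Pres.δ X R ω (kk g x) ≈F Pres.Logged.WithNF.edgeWord X R ω 𝓛 nf g x)
    × ((i : Σ (Word X) (Pres.Logged.Irreducible X R ω 𝓛) × R) →
        Pres.InPi2 X R ω (Pres.Logged.WithNF.iota X R ω 𝓛 nf kk i))
    × ((c : Pres.Yseq X R ω) → Pres.InPi2 X R ω c →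
        Pres.GeneratedBy X R ω (Pres.Logged.WithNF.iota X R ω 𝓛 nf kk) c)
mainTheorem1 X R ω 𝓛 complete nf isNF kk isK1 = δ-kk , iota-InPi2 , InPi2⇒generated
  where open CompleteRewriting X R ω 𝓛 complete nf isNF
        open K1 kk isK1
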